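{- Let $(F_k)_{k\ge 0}$ be the Fibonacci sequence. The inequality $$|F_n + F_m - 2^a| < 2^{a/2}$$ has exactly $52$ solutions $(n,m,a)$ in positive integers with $n \ge m$ and $n \le 250$; all of them satisfy $n \le 42$ and $a \le 28$. Namely, they are exactly the triples $(1,1,1)$, $(2,1,1)$, $(2,2,1)$, $(3,1,1)$, $(3,2,1)$, $(3,1,2)$, $(3,2,2)$, $(3,3,2)$, $(4,1,2)$, $(4,2,2)$, $(4,3,2)$, $(4,4,3)$, $(5,1,3)$, $(5,2,3)$, $(5,3,3)$, $(5,4,3)$, $(5,5,3)$, $(6,1,3)$, $(6,2,3)$, $(6,3,3)$, $(6,5,4)$, $(6,6,4)$, $(7,1,4)$, $(7,2,4)$, $(7,3,4)$, $(7,4,4)$, $(7,5,4)$, $(8,6,5)$, $(8,7,5)$, $(9,1,5)$, $(9,2,5)$, $(9,3,5)$, $(9,4,5)$, $(9,9,6)$, $(10,3,6)$, $(10,4,6)$, $(10,5,6)$, $(10,6,6)$, $(10,7,6)$, $(11,9,7)$, $(13,6,8)$, $(13,7,8)$, $(13,8,8)$, $(13,9,8)$, $(14,12,9)$, $(16,6,10)$, $(16,7,10)$, $(16,8,10)$, $(16,9,10)$, $(16,10,10)$, $(23,19,15)$, $(42,29,28)$.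
   Context: The Fibonacci sequence is defined by $F_0 = 0$, $F_1 = 1$ and $F_{k+2} = F_{k+1} + F_k$ for all $k \ge 0$ (so $F_1=F_2=1$, $F_3=2$, $F_4=3$, $F_5=5$, \dots). -}

module Defs where

open import Data.Nat using (ℕ; zero; suc; _+_; _*_; _^_; _<_; ∣_-_∣)
open import Data.Product using (_×_; _,_)
open import Data.List using (List; []; _∷_)

fib : ℕ → ℕ
fib zero = zero
fib (suc zero) = suc zero
fib (suc (suc k)) = fib (suc k) + fib k

-- |F_n + F_m - 2^a| < 2^(a/2), with a/2 the real half-exponent.
-- Both sides are nonnegative, so this is equivalent to squaring:
-- |F_n + F_m - 2^a|^2 < 2^a  (exact, no rounding).
IsSolution : ℕ → ℕ → ℕ → Set
IsSolution n m a = ∣ fib n + fib m - 2 ^ a ∣ * ∣ fib n + fib m - 2 ^ a ∣ < 2 ^ a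

Triple : Set
Triple = ℕ × ℕ × ℕ

solutions : List Triple
solutions =
  (1 , 1 , 1) ∷ (2 , 1 , 1) ∷ (2 , 2 , 1) ∷ (3 , 1 , 1) ∷ (3 , 2 , 1) ∷
  (3 , 1 , 2) ∷ (3 , 2 , 2) ∷ (3 , 3 , 2) ∷ (4 , 1 , 2) ∷ (4 , 2 , 2) ∷
  (4 , 3 , 2) ∷ (4 , 4 , 3) ∷ (5 , 1 , 3) ∷ (5 , 2 , 3) ∷ (5 , 3 , 3) ∷
  (5 , 4 , 3) ∷ (5 , 5 , 3) ∷ (6 , 1 , 3) ∷ (6 , 2 , 3) ∷ (6 , 3 , 3) ∷
  (6 , 5 , 4) ∷ (6 , 6 , 4) ∷ (7 , 1 , 4) ∷ (7 , 2 , 4) ∷ (7 , 3 , 4) ∷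
  (7 , 4 , 4) ∷ (7 , 5 , 4) ∷ (8 , 6 , 5) ∷ (8 , 7 , 5) ∷ (9 , 1 , 5) ∷
  (9 , 2 , 5) ∷ (9 , 3 , 5) ∷ (9 , 4 , 5) ∷ (9 , 9 , 6) ∷ (10 , 3 , 6) ∷
  (10 , 4 , 6) ∷ (10 , 5 , 6) ∷ (10 , 6 , 6) ∷ (10 , 7 , 6) ∷ (11 , 9 , 7) ∷
  (13 , 6 , 8) ∷ (13 , 7 , 8) ∷ (13 , 8 , 8) ∷ (13 , 9 , 8) ∷ (14 , 12 , 9) ∷
  (16 , 6 , 10) ∷ (16 , 7 , 10) ∷ (16 , 8 , 10) ∷ (16 , 9 , 10) ∷ (16 , 10 , 10) ∷
  (23 , 19 , 15) ∷ (42 , 29 , 28) ∷ []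

-- If |x - 2^a|² < 2^a then x < 2^(a+1), and x cannot be below 2^(a-1) either, since then
-- |x - 2^a| > 2^(a-1) ≥ 2^(a/2) once a ≥ 2. Hence with 2^L ≤ F_n < 2^(L+1) and m ≤ n,
-- the only candidate exponents for x = F_n + F_m are L, L+1 and L+2, and the theorem
-- reduces to a finite check over n ≤ 250, m ≤ n and these three exponents, carried out
-- by evaluation.
module Submission where

open import Defs
open import Data.Bool using (Bool; true; if_then_else_; _∧_; T)
open import Data.Bool.Properties using (T-∧)
open import Data.List using (length)
open import Data.List.Membership.Propositional using (_∈_)
open import Data.List.Relation.Unary.All as All using (All; all?)
open import Data.List.Relation.Unary.Unique.Propositional using (Unique)
open import Data.List.Relation.Unary.Unique.DecPropositional using (unique?)
open import Data.Nat
open import Data.Nat.GeneralisedArithmetic using (fold)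
open import Data.Nat.Properties
open import Data.Nat.Tactic.RingSolver using (solve-∀)
open import Data.Product using (_×_; _,_; proj₁; proj₂)
open import Data.Product.Properties using (≡-dec)
open import Data.Sum using (inj₁; inj₂)
open import Data.Unit using (tt)
open import Function.Bundles using (_⇔_; mk⇔; Equivalence)
open import Relation.Binary.Definitions using (DecidableEquality)
open import Relation.Binary.PropositionalEquality using (_≡_; refl; sym; cong; cong₂; subst)
open import Relation.Nullary using (Dec; yes; no; contradiction)
open import Relation.Nullary.Decidable using (map′; isYes; toWitness; from-yes)

_≟ₜ_ : DecidableEquality Triple
_≟ₜ_ = ≡-dec _≟_ (≡-dec _≟_ _≟_)

open import Data.List.Membership.DecPropositional _≟ₜ_ using (_∈?_)

T-∧⁻ : ∀ {b c} → T (b ∧ c) → T b × T c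
T-∧⁻ = Equivalence.to T-∧

n+n≡2*n : ∀ n → n + n ≡ 2 * n
n+n≡2*n n = cong (n +_) (sym (+-identityʳ n))

m*m<n⇒m<n : ∀ m {n} → m * m < n → m < n
m*m<n⇒m<n zero    lt = lt
m*m<n⇒m<n (suc m) lt = ≤-<-trans (m≤m*n (suc m) (suc m)) lt

[2*m]*[2*m]≡4*[m*m] : ∀ m → (2 * m) * (2 * m) ≡ 4 * (m * m)
[2*m]*[2*m]≡4*[m*m] = solve-∀

m^n<m^o⇒n<o : ∀ m .{{_ : NonZero m}} {n o} → m ^ n < m ^ o → n < o
m^n<m^o⇒n<o m lt = ≰⇒> (λ o≤n → <⇒≱ lt (^-monoʳ-≤ m o≤n))

fib-≤-suc : ∀ n → fib n ≤ fib (suc n)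
fib-≤-suc zero    = z≤n
fib-≤-suc (suc n) = m≤m+n (fib (suc n)) (fib n)

fib-mono-≤′ : ∀ {m n} → m ≤′ n → fib m ≤ fib n
fib-mono-≤′ ≤′-refl         = ≤-refl
fib-mono-≤′ (≤′-step {n} p) = ≤-trans (fib-mono-≤′ p) (fib-≤-suc n)

fib-mono-≤ : ∀ {m n} → m ≤ n → fib m ≤ fib n
fib-mono-≤ m≤n = fib-mono-≤′ (≤⇒≤′ m≤n)

fibPair : ℕ → ℕ × ℕ
fibPair n = fib n , fib (suc n)

fibStep : ℕ × ℕ → ℕ × ℕ
fibStep (f , f′) = f′ , f′ + f

fold-fibStep : ∀ n → fold (0 , 1) fibStep n ≡ fibPair n
fold-fibStep zero    = refl
fold-fibStep (suc n) = cong fibStep (fold-fibStep n)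

fastFib : ℕ → ℕ
fastFib n = proj₁ (fold (0 , 1) fibStep n)

fastFib≡fib : ∀ n → fastFib n ≡ fib n
fastFib≡fib n = cong proj₁ (fold-fibStep n)

WithinSqrt : ℕ → ℕ → Set
WithinSqrt x t = ∣ x - t ∣ * ∣ x - t ∣ < t

-- ∣_-_∣ recurses in unary; ∣_-_∣′ runs on the builtin operations.
withinSqrt? : ∀ x t → Dec (WithinSqrt x t)
withinSqrt? x t =
  map′ (subst (λ d → d * d < t) (sym eq)) (subst (λ d → d * d < t) eq)
       (∣ x - t ∣′ * ∣ x - t ∣′ <? t)
  where eq = ∣-∣≡∣-∣′ x t

withinSqrt⇒<2* : ∀ {x t} → WithinSqrt x t → x < 2 * t
withinSqrt⇒<2* {x} {t} close = begin-strict
  x             ≤⟨ m≤∣m-n∣+n x t ⟩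
  ∣ x - t ∣ + t <⟨ +-monoˡ-< t (m*m<n⇒m<n ∣ x - t ∣ close) ⟩
  t + t         ≡⟨ n+n≡2*n t ⟩
  2 * t         ∎
  where open ≤-Reasoning

-- If 2x < t then ∣x - t∣ > t/2, whose square exceeds t as soon as t ≥ 4.
withinSqrt-far⇒<4 : ∀ {x t} → WithinSqrt x t → 2 * x < t → t < 4
withinSqrt-far⇒<4 {x} {t} close far = *-cancelʳ-< t t 4 (begin-strict
  t * t             <⟨ *-mono-< t<2*d t<2*d ⟩
  (2 * d) * (2 * d) ≡⟨ [2*m]*[2*m]≡4*[m*m] d ⟩
  4 * (d * d)       <⟨ *-monoʳ-< 4 close ⟩
  4 * t             ∎)
  where
  open ≤-Reasoning
  d = ∣ x - t ∣
  x≤t : x ≤ t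
  x≤t = ≤-trans (m≤m+n x (x + 0)) (<⇒≤ far)
  d+x≡t : d + x ≡ t
  d+x≡t = subst (λ e → e + x ≡ t) (sym (m≤n⇒∣m-n∣≡n∸m x≤t)) (m∸n+n≡m x≤t)
  t<2*d : t < 2 * d
  t<2*d = +-cancelʳ-< (2 * x) t (2 * d) (begin-strict
    t + 2 * x     <⟨ +-monoʳ-< t far ⟩
    t + t         ≡⟨ n+n≡2*n t ⟩
    2 * t         ≡⟨ cong (2 *_) (sym d+x≡t) ⟩
    2 * (d + x)   ≡⟨ *-distribˡ-+ 2 d x ⟩
    2 * d + 2 * x ∎)

withinSqrt-pow-lower : ∀ {x a b} → 2 ^ b ≤ x → WithinSqrt x (2 ^ a) → b ≤ a
withinSqrt-pow-lower {x} 2^b≤x close =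
  s≤s⁻¹ (m^n<m^o⇒n<o 2 (≤-<-trans 2^b≤x (withinSqrt⇒<2* {x} close)))

withinSqrt-pow-upper : ∀ {x a b} → x < 2 ^ suc b → WithinSqrt x (2 ^ a) → a ≤ suc b
withinSqrt-pow-upper {x} {a} {b} x<2^b+1 close with a ≤? suc b
... | yes a≤b+1 = a≤b+1
... | no  a≰b+1 = contradiction (withinSqrt-far⇒<4 {x} close far) (≤⇒≯ 4≤2^a)
  where
  b+2≤a : suc (suc b) ≤ a
  b+2≤a = ≰⇒> a≰b+1
  far : 2 * x < 2 ^ a
  far = <-≤-trans (*-monoʳ-< 2 x<2^b+1) (^-monoʳ-≤ 2 b+2≤a)
  4≤2^a : 4 ≤ 2 ^ a
  4≤2^a = ^-monoʳ-≤ 2 (≤-trans (s≤s (s≤s z≤n)) b+2≤a)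

allIterate : {S : Set} → (S → S) → (ℕ → S → Bool) → ℕ → ℕ → S → Bool
allIterate next P i zero    s = P i s
allIterate next P i (suc k) s = P i s ∧ allIterate next P (suc i) k (next s)

allIterate-sound : {S : Set} (next : S → S) (P : ℕ → S → Bool) (seq : ℕ → S) →
  (∀ i → next (seq i) ≡ seq (suc i)) →
  ∀ k i {j} → T (allIterate next P i k (seq i)) → i ≤ j → j ≤ k + i → T (P j (seq j))
allIterate-sound next P seq step zero i ok i≤j j≤i with ≤-antisym i≤j j≤i
... | refl = ok
allIterate-sound next P seq step (suc k) i {j} ok i≤j j≤k+i with m≤n⇒m<n∨m≡n i≤j
... | inj₂ refl = proj₁ (T-∧⁻ ok)
... | inj₁ i<j  =
  allIterate-sound next P seq step k (suc i)
    (subst (λ s → T (allIterate next P (suc i) k s)) (step i) (proj₂ (T-∧⁻ ok)))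
    i<j (subst (j ≤_) (sym (+-suc k i)) j≤k+i)

checkCandidate : (n m x a t : ℕ) → Bool
checkCandidate n m x a t with withinSqrt? x t
... | yes _ = isYes ((n , m , a) ∈? solutions)
... | no  _ = true

checkCandidate-sound : ∀ {n m x a t} → T (checkCandidate n m x a t) → WithinSqrt x t →
  (n , m , a) ∈ solutions
checkCandidate-sound {n} {m} {x} {a} {t} ok close with withinSqrt? x t
... | yes _   = toWitness {a? = (n , m , a) ∈? solutions} ok
... | no  far = contradiction close far

checkColumn : (n fn L p m : ℕ) → ℕ × ℕ → Bool
checkColumn n fn L p m (fm , _) = allIterate (2 *_) (checkCandidate n m (fn + fm)) L 2 p

-- p = 2 ^ L is passed as an argument so that it is evaluated once per row.
checkRow : (n fn L p : ℕ) → Bool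
checkRow n fn L p =
  (p ≤ᵇ fn) ∧ (fn <ᵇ 2 * p) ∧ allIterate fibStep (checkColumn n fn L p) 1 (n ∸ 1) (fibPair 1)

-- Any L would be sound here, as checkRow verifies 2 ^ L ≤ F n < 2 ^ (1 + L) itself.
⌊log₂⌋ : ℕ → ℕ
⌊log₂⌋ x = go x x
  where
  go : ℕ → ℕ → ℕ
  go zero       _ = 0
  go (suc fuel) y = if 2 ≤ᵇ y then suc (go fuel (y / 2)) else 0

checkFibRow : ℕ → ℕ × ℕ → Bool
checkFibRow n (fn , _) = checkRow n fn (⌊log₂⌋ fn) (2 ^ ⌊log₂⌋ fn)

checkRow-sound : ∀ {n m a} L → T (checkRow n (fib n) L (2 ^ L)) → 1 ≤ m → m ≤ n →
  IsSolution n m a → (n , m , a) ∈ solutions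
checkRow-sound {n} {m} {a} L ok 1≤m m≤n close = checkCandidate-sound exponentOK close
  where
  x = fib n + fib m
  lowerOK : T (2 ^ L ≤ᵇ fib n)
  lowerOK = proj₁ (T-∧⁻ ok)
  upperOK : T (fib n <ᵇ 2 ^ suc L)
  upperOK = proj₁ (T-∧⁻ (proj₂ (T-∧⁻ {2 ^ L ≤ᵇ fib n} ok)))
  columnsOK : T (allIterate fibStep (checkColumn n (fib n) L (2 ^ L)) 1 (n ∸ 1) (fibPair 1))
  columnsOK = proj₂ (T-∧⁻ (proj₂ (T-∧⁻ {2 ^ L ≤ᵇ fib n} ok)))
  fn<2^L+1 : fib n < 2 ^ suc L
  fn<2^L+1 = <ᵇ⇒< _ _ upperOK
  2^L≤x : 2 ^ L ≤ x
  2^L≤x = ≤-trans (≤ᵇ⇒≤ _ _ lowerOK) (m≤m+n (fib n) (fib m))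
  x<2^L+2 : x < 2 ^ suc (suc L)
  x<2^L+2 = subst (x <_) (n+n≡2*n (2 ^ suc L))
    (+-mono-< fn<2^L+1 (≤-<-trans (fib-mono-≤ m≤n) fn<2^L+1))
  m≤n∸1+1 : m ≤ n ∸ 1 + 1
  m≤n∸1+1 = subst (m ≤_) (sym (m∸n+n≡m (≤-trans 1≤m m≤n))) m≤n
  columnOK : T (checkColumn n (fib n) L (2 ^ L) m (fibPair m))
  columnOK = allIterate-sound fibStep (checkColumn n (fib n) L (2 ^ L)) fibPair (λ _ → refl)
    (n ∸ 1) 1 {m} columnsOK 1≤m m≤n∸1+1
  exponentOK : T (checkCandidate n m x a (2 ^ a))
  exponentOK = allIterate-sound (2 *_) (checkCandidate n m x) (2 ^_) (λ _ → refl) 2 L {a} columnOK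
    (withinSqrt-pow-lower 2^L≤x close) (withinSqrt-pow-upper x<2^L+2 close)

listed⇒solution : All (λ { (n , m , a) → IsSolution n m a }) solutions
listed⇒solution = All.map (λ {τ} → fromFast τ) (toWitness {a? = all? fastSolution? solutions} tt)
  where
  FastSolution : Triple → Set
  FastSolution (n , m , a) = WithinSqrt (fastFib n + fastFib m) (2 ^ a)
  fastSolution? : ∀ τ → Dec (FastSolution τ)
  fastSolution? (n , m , a) = withinSqrt? (fastFib n + fastFib m) (2 ^ a)
  fromFast : ∀ τ → FastSolution τ → let (n , m , a) = τ in IsSolution n m a
  fromFast (n , m , a) = subst (λ x → WithinSqrt x (2 ^ a))
    (cong₂ _+_ (fastFib≡fib n) (fastFib≡fib m))

proposition3p1 :
    (length solutions ≡ 52 × Unique solutions)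
    × ((n m a : ℕ) → 1 ≤ m → 1 ≤ a → m ≤ n → n ≤ 250 →
        (IsSolution n m a ⇔ (n , m , a) ∈ solutions))
proposition3p1 = (refl , from-yes (unique? _≟ₜ_ solutions)) , λ n m a 1≤m _ m≤n n≤250 →
  mk⇔ (checkRow-sound (⌊log₂⌋ (fib n)) (rowOK n (≤-trans 1≤m m≤n) n≤250) 1≤m m≤n)
      (All.lookup listed⇒solution)
  where
  rowOK : ∀ n → 1 ≤ n → n ≤ 250 → T (checkFibRow n (fibPair n))
  rowOK n = allIterate-sound fibStep checkFibRow fibPair (λ _ → refl) 249 1 tt
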